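{- Let $G$ be a finite connected graph and $P_r$ the path on $r$ vertices. If $r\geq {\rm diam}(G)\,|V(G)|$, then ${\rm ip}_{p}(P_r\,\square\, G)\geq {\rm ip}_{c}(P_r\,\square\, G)\geq |V(G)|$.
   Context: $P_r\,\square\, G$ is the Cartesian product and ${\rm diam}(G)$ the diameter of $G$. A path is isometric if its length equals the distance between its endpoints; single vertices count as paths. ${\rm ip}_{c}(H)$ (resp. ${\rm ip}_{p}(H)$) is the minimum number of isometric paths of $H$ whose vertex sets cover (resp. partition) $V(H)$. -}

module Defs where

open import Data.Nat using (ℕ; zero; suc; _≤_)
open import Data.Fin using (Fin; toℕ; inject₁) renaming (zero to fzero; suc to fsuc)
open import Data.Vec using (Vec; lookup; head; last)
open import Data.List using (List; length)
import Data.List as L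
open import Data.Product using (Σ; ∃; ∃-syntax; _×_; _,_)
open import Data.Sum using (_⊎_)
open import Relation.Binary.PropositionalEquality using (_≡_)
open import Relation.Nullary using (¬_)
open import Relation.Binary using (Decidable)

record Graph (V : Set) : Set₁ where
  field
    Adj    : V → V → Set
    adj?   : Decidable Adj
    adj-sym : ∀ {x y} → Adj x y → Adj y x
    irrefl : ∀ {x} → ¬ Adj x x
open Graph public

module _ {V : Set} (G : Graph V) where

  data Walk : V → V → ℕ → Set where
    here : ∀ {u} → Walk u u zero
    step : ∀ {u w v k} → Adj G u w → Walk w v k → Walk u v (suc k)

  Connected : Set
  Connected = ∀ u v → ∃[ k ] Walk u v k

  IsDist : V → V → ℕ → Set
  IsDist u v d = Walk u v d × (∀ k → Walk u v k → d ≤ k)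

  IsDiam : ℕ → Set
  IsDiam D = (∀ u v → ∃[ d ] (IsDist u v d × d ≤ D))
           × (∃[ u ] ∃[ v ] IsDist u v D)

  record IsoPath : Set where
    field
      len       : ℕ
      verts     : Vec V (suc len)
      adjacent  : ∀ (i : Fin len) → Adj G (lookup verts (inject₁ i)) (lookup verts (fsuc i))
      distinct  : ∀ (i j : Fin (suc len)) → lookup verts i ≡ lookup verts j → i ≡ j
      isometric : IsDist (head verts) (last verts) len
  open IsoPath public

  OnPath : V → IsoPath → Set
  OnPath x P = ∃[ i ] lookup (verts P) i ≡ x

  IsCover : List IsoPath → Set
  IsCover ps = ∀ x → ∃[ j ] OnPath x (L.lookup ps j)

  IsPartition : List IsoPath → Set
  IsPartition ps = ∀ x → ∃[ j ] (OnPath x (L.lookup ps j)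
                                × (∀ j' → OnPath x (L.lookup ps j') → j' ≡ j))

  IsIPc : ℕ → Set
  IsIPc c = (∃[ ps ] (IsCover ps × length ps ≡ c))
          × (∀ ps → IsCover ps → c ≤ length ps)

  IsIPp : ℕ → Set
  IsIPp p = (∃[ ps ] (IsPartition ps × length ps ≡ p))
          × (∀ ps → IsPartition ps → p ≤ length ps)

PathAdj : ∀ {r} → Fin r → Fin r → Set
PathAdj a b = (toℕ b ≡ suc (toℕ a)) ⊎ (toℕ a ≡ suc (toℕ b))


private
  open import Data.Nat.Properties as ℕP using ()
  open import Data.Fin.Properties as FP using ()
  open import Relation.Nullary using (Dec; yes; no)
  open import Data.Sum using (inj₁; inj₂)
  open import Relation.Binary.PropositionalEquality using (refl; sym; trans; subst)
  open import Data.Empty using (⊥-elim)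

  pathAdj? : ∀ {r} → Decidable (PathAdj {r})
  pathAdj? a b with toℕ b ℕP.≟ suc (toℕ a) | toℕ a ℕP.≟ suc (toℕ b)
  ... | yes p | _ = yes (inj₁ p)
  ... | no _ | yes q = yes (inj₂ q)
  ... | no p | no q = no λ { (inj₁ x) → p x ; (inj₂ x) → q x }

  pathSym : ∀ {r} {a b : Fin r} → PathAdj a b → PathAdj b a
  pathSym (inj₁ p) = inj₂ p
  pathSym (inj₂ p) = inj₁ p

  pathIrr : ∀ {r} {a : Fin r} → ¬ PathAdj a a
  pathIrr (inj₁ p) = ℕP.1+n≢n (sym p)
  pathIrr (inj₂ p) = ℕP.1+n≢n (sym p)

P : (r : ℕ) → Graph (Fin r)
P r = record { Adj = PathAdj ; adj? = pathAdj? ; adj-sym = pathSym ; irrefl = pathIrr }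

ProdAdj : ∀ {m n} → Graph (Fin m) → Graph (Fin n) → Fin m × Fin n → Fin m × Fin n → Set
ProdAdj G H (a , x) (b , y) = (a ≡ b × Adj H x y) ⊎ (x ≡ y × Adj G a b)

private
  open import Relation.Nullary using (_×-dec_; _⊎-dec_)
  prodAdj? : ∀ {m n} (G : Graph (Fin m)) (H : Graph (Fin n)) → Decidable (ProdAdj G H)
  prodAdj? G H (a , x) (b , y) = ((a FP.≟ b) ×-dec adj? H x y) ⊎-dec ((x FP.≟ y) ×-dec adj? G a b)

  prodSym : ∀ {m n} (G : Graph (Fin m)) (H : Graph (Fin n)) {u v} → ProdAdj G H u v → ProdAdj G H v u
  prodSym G H (inj₁ (e , h)) = inj₁ (sym e , Graph.adj-sym H h)
  prodSym G H (inj₂ (e , g)) = inj₂ (sym e , Graph.adj-sym G g)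

  prodIrr : ∀ {m n} (G : Graph (Fin m)) (H : Graph (Fin n)) {u} → ¬ ProdAdj G H u u
  prodIrr G H (inj₁ (_ , h)) = irrefl H h
  prodIrr G H (inj₂ (_ , g)) = irrefl G g

_□_ : ∀ {m n} → Graph (Fin m) → Graph (Fin n) → Graph (Fin m × Fin n)
G □ H = record { Adj = ProdAdj G H ; adj? = prodAdj? G H ; adj-sym = prodSym G H ; irrefl = prodIrr G H }

module Submission where

open import Defs
open import Data.Nat using (ℕ; _≤_; _*_; NonZero)
open import Data.Fin using (Fin)
open import Data.Product using (∃-syntax; _×_)

open import Data.Nat using (zero; suc; _+_; _∸_; _<_; s≤s; >-nonZero⁻¹)
open import Data.Nat.Properties
open import Data.Fin using (toℕ; fromℕ; fromℕ<; inject₁; inject≤; cast; combine; remQuot)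
  renaming (zero to fzero; suc to fsuc)
import Data.Fin.Properties as Finₚ
open import Data.Vec using (lookup; head; last; tabulate)
open import Data.Vec.Properties using (lookup∘tabulate)
open import Data.List using (List; length)
import Data.List as List
import Data.List.Properties as Listₚ
open import Data.Product using (_,_; proj₁; proj₂; uncurry)
open import Data.Sum using (inj₁; inj₂)
open import Function using (_∘_)
open import Function.Definitions using (Injective)
open import Relation.Binary.PropositionalEquality

-- A path in P_r □ G has at most r + diam(G) vertices, since any two vertices are at
-- distance < r + diam(G).  Hence a cover of the r·|V(G)| vertices by m isometric paths
-- forces r·|V(G)| ≤ m (r + diam(G)), and when diam(G)·|V(G)| ≤ r this gives m ≥ |V(G)|.
-- Conversely the |V(G)| fibres P_r × {x} are isometric paths partitioning the vertices,
-- so ip_c = ip_p = |V(G)|.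

module _ {V : Set} (G : Graph V) where

  walk-snoc : ∀ {u v w k} → Walk G u v k → Adj G v w → Walk G u w (suc k)
  walk-snoc here       e = step e here
  walk-snoc (step a w) e = step a (walk-snoc w e)

  walk-reverse : ∀ {u v k} → Walk G u v k → Walk G v u k
  walk-reverse here       = here
  walk-reverse (step a w) = walk-snoc (walk-reverse w) (adj-sym G a)

  walk-++ : ∀ {u v w k l} → Walk G u v k → Walk G v w l → Walk G u w (k + l)
  walk-++ here       w = w
  walk-++ (step a p) w = step a (walk-++ p w)

  isometric-len< : ∀ {B} → (∀ u v → ∃[ k ] (Walk G u v k × k < B)) →
                   (p : IsoPath G) → len p < B
  isometric-len< short p with short (head (verts p)) (last (verts p))
  ... | k , w , k<B = ≤-<-trans (proj₂ (isometric p) k w) k<B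

  IsPartition⇒IsCover : ∀ ps → IsPartition G ps → IsCover G ps
  IsPartition⇒IsCover ps part x = proj₁ (part x) , proj₁ (proj₂ (part x))

  -- Numbering the vertices on each path sends vertex ι k to a slot (path j, position i)
  -- of a (length ps) × B grid, and distinct vertices get distinct slots.
  cover-size : ∀ {N B} (ι : Fin N → V) → Injective _≡_ _≡_ ι →
               (∀ p → len p < B) →
               ∀ ps → IsCover G ps → N ≤ length ps * B
  cover-size {B = B} ι ι-inj len<B ps cover = Finₚ.injective⇒≤ slot-injective
    where
      slot-of : ∀ {j} → Fin (suc (len (List.lookup ps j))) → Fin B
      slot-of {j} i = inject≤ i (len<B (List.lookup ps j))

      slot : Fin _ → Fin (length ps * B)
      slot k with cover (ι k)
      ... | j , i , _ = combine j (slot-of i)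

      slot-injective : Injective _≡_ _≡_ slot
      slot-injective {k} {k′} eq with cover (ι k) | cover (ι k′)
      ... | j , i , on | j′ , i′ , on′
        with refl ← proj₁ (Finₚ.combine-injective j (slot-of i) j′ (slot-of i′) eq) =
        ι-inj (begin
          ι k                                    ≡⟨ on ⟨
          lookup (verts (List.lookup ps j)) i    ≡⟨ cong (lookup (verts (List.lookup ps j))) i≡i′ ⟩
          lookup (verts (List.lookup ps j)) i′   ≡⟨ on′ ⟩
          ι k′                                   ∎)
        where
          open ≡-Reasoning
          i≡i′ : i ≡ i′
          i≡i′ = Finₚ.inject≤-injective _ _ i i′ (proj₂ (Finₚ.combine-injective j (slot-of i) j (slot-of i′) eq))

P-walk-up : ∀ {r} k (a b : Fin r) → toℕ b ≡ k + toℕ a → Walk (P r) a b k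
P-walk-up zero    a b eq = subst (λ b → Walk (P _) a b 0) (Finₚ.toℕ-injective (sym eq)) here
P-walk-up {r} (suc k) a b eq = step (inj₁ (Finₚ.toℕ-fromℕ< a+1<r)) (P-walk-up k a+1 b eq′)
  where
    a+1<r : suc (toℕ a) < r
    a+1<r = ≤-trans (s≤s (s≤s (m≤n+m (toℕ a) k))) (subst (_< r) eq (Finₚ.toℕ<n b))
    a+1 : Fin r
    a+1 = fromℕ< a+1<r
    eq′ : toℕ b ≡ k + toℕ a+1
    eq′ = trans eq (trans (sym (+-suc k (toℕ a))) (cong (k +_) (sym (Finₚ.toℕ-fromℕ< a+1<r))))

P-walk : ∀ {r} (a b : Fin r) → ∃[ k ] (Walk (P r) a b k × k < r)
P-walk a b with ≤-total (toℕ a) (toℕ b)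
... | inj₁ a≤b = toℕ b ∸ toℕ a , P-walk-up _ a b (sym (m∸n+n≡m a≤b)) ,
                 ≤-<-trans (m∸n≤m (toℕ b) (toℕ a)) (Finₚ.toℕ<n b)
... | inj₂ b≤a = toℕ a ∸ toℕ b , walk-reverse (P _) (P-walk-up _ b a (sym (m∸n+n≡m b≤a))) ,
                 ≤-<-trans (m∸n≤m (toℕ a) (toℕ b)) (Finₚ.toℕ<n a)

module _ {r n : ℕ} (G : Graph (Fin n)) where

  walk-□ˡ : ∀ {a b k} (x : Fin n) → Walk (P r) a b k → Walk (P r □ G) (a , x) (b , x) k
  walk-□ˡ x here       = here
  walk-□ˡ x (step e w) = step (inj₂ (refl , e)) (walk-□ˡ x w)

  walk-□ʳ : ∀ {x y k} (a : Fin r) → Walk G x y k → Walk (P r □ G) (a , x) (a , y) k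
  walk-□ʳ a here       = here
  walk-□ʳ a (step e w) = step (inj₁ (refl , e)) (walk-□ʳ a w)

  walk-□-proj₁ : ∀ {u v k} → Walk (P r □ G) u v k → toℕ (proj₁ v) ≤ toℕ (proj₁ u) + k
  walk-□-proj₁ {u} here = m≤m+n (toℕ (proj₁ u)) 0
  walk-□-proj₁ {u} {k = suc k} (step e w) = begin
    _                          ≤⟨ walk-□-proj₁ w ⟩
    _ + k                      ≤⟨ +-monoˡ-≤ k (adj-proj₁ e) ⟩
    suc (toℕ (proj₁ u)) + k    ≡⟨ +-suc (toℕ (proj₁ u)) k ⟨
    toℕ (proj₁ u) + suc k      ∎
    where
      open ≤-Reasoning
      adj-proj₁ : ∀ {u w} → Adj (P r □ G) u w → toℕ (proj₁ w) ≤ suc (toℕ (proj₁ u))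
      adj-proj₁ (inj₁ (refl , _))       = n≤1+n _
      adj-proj₁ (inj₂ (_ , inj₁ b≡a+1)) = ≤-reflexive b≡a+1
      adj-proj₁ (inj₂ (_ , inj₂ a≡b+1)) = ≤-trans (n≤1+n _) (≤-trans (≤-reflexive (sym a≡b+1)) (n≤1+n _))

  □-walk : ∀ {D} → IsDiam G D → ∀ u v → ∃[ k ] (Walk (P r □ G) u v k × k < r + D)
  □-walk diam (a , x) (b , y) with P-walk a b | proj₁ diam x y
  ... | k , w , k<r | d , (wd , _) , d≤D =
    k + d , walk-++ (P r □ G) (walk-□ˡ x w) (walk-□ʳ b wd) , +-mono-<-≤ k<r d≤D

  □-cover-size : ∀ {D} → IsDiam G D → ∀ ps → IsCover (P r □ G) ps → r * n ≤ length ps * (r + D)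
  □-cover-size diam = cover-size (P r □ G) (remQuot n) remQuot-injective
                        (isometric-len< (P r □ G) (□-walk diam))
    where
      remQuot-injective : Injective _≡_ _≡_ (remQuot {r} n)
      remQuot-injective {k} {k′} eq = begin
        k                              ≡⟨ Finₚ.combine-remQuot {r} n k ⟨
        uncurry combine (remQuot {r} n k)  ≡⟨ cong (uncurry combine) eq ⟩
        uncurry combine (remQuot {r} n k′) ≡⟨ Finₚ.combine-remQuot {r} n k′ ⟩
        k′                             ∎
        where open ≡-Reasoning

cover-size⇒≤ : ∀ r n m D → .{{NonZero r}} → D * n ≤ r → r * n ≤ m * (r + D) → n ≤ m
cover-size⇒≤ r n m D Dn≤r rn≤m[r+D] = ≮⇒≥ λ m<n → <⇒≱ (m[r+D]<rn m<n) rn≤m[r+D]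
  where
    mD<r : ∀ D → D * n ≤ r → m < n → m * D < r
    mD<r zero    _    _   = subst (_< r) (sym (*-zeroʳ m)) (>-nonZero⁻¹ r)
    mD<r (suc d) Dn≤r m<n = <-≤-trans (*-monoˡ-< (suc d) m<n) (subst (_≤ r) (*-comm (suc d) n) Dn≤r)

    m[r+D]<rn : m < n → m * (r + D) < r * n
    m[r+D]<rn m<n = begin-strict
      m * (r + D)    ≡⟨ *-distribˡ-+ m r D ⟩
      m * r + m * D  <⟨ +-monoʳ-< (m * r) (mD<r D Dn≤r m<n) ⟩
      m * r + r      ≡⟨ +-comm (m * r) r ⟩
      suc m * r      ≤⟨ *-monoˡ-≤ r m<n ⟩
      n * r          ≡⟨ *-comm n r ⟩
      r * n          ∎
      where open ≤-Reasoning

last-tabulate : ∀ {A : Set} k (f : Fin (suc k) → A) → last (tabulate f) ≡ f (fromℕ k)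
last-tabulate zero    f = refl
last-tabulate (suc k) f = last-tabulate k (f ∘ fsuc)

module Fibres {r′ n : ℕ} (G : Graph (Fin n)) where

  H : Graph (Fin (suc r′) × Fin n)
  H = P (suc r′) □ G

  at : Fin n → Fin (suc r′) → Fin (suc r′) × Fin n
  at x a = a , x

  fibre : Fin n → IsoPath H
  fibre x = record
    { len       = r′
    ; verts     = tabulate (at x)
    ; adjacent  = λ i → subst₂ (Adj H) (sym (lookup∘tabulate (at x) (inject₁ i)))
                                       (sym (lookup∘tabulate (at x) (fsuc i)))
                                       (inj₂ (refl , inj₁ (cong suc (sym (Finₚ.toℕ-inject₁ i)))))
    ; distinct  = λ i j eq → cong proj₁ (trans (sym (lookup∘tabulate (at x) i))
                                         (trans eq (lookup∘tabulate (at x) j)))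
    ; isometric = subst (λ v → Walk H (fzero , x) v r′) (sym (last-tabulate r′ (at x))) end-to-end
                , λ k w → subst (_≤ k) (Finₚ.toℕ-fromℕ r′)
                            (walk-□-proj₁ G (subst (λ v → Walk H (fzero , x) v k) (last-tabulate r′ (at x)) w))
    }
    where
      end-to-end : Walk H (fzero , x) (fromℕ r′ , x) r′
      end-to-end = walk-□ˡ G x (P-walk-up r′ fzero (fromℕ r′)
                                  (trans (Finₚ.toℕ-fromℕ r′) (sym (+-identityʳ r′))))

  fibres : List (IsoPath H)
  fibres = List.tabulate fibre

  length-fibres : length fibres ≡ n
  length-fibres = Listₚ.length-tabulate fibre

  lookup-fibres : ∀ j → List.lookup fibres j ≡ fibre (cast length-fibres j)
  lookup-fibres j = trans (cong (List.lookup fibres) (sym (Finₚ.cast-involutive _ length-fibres j)))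
                          (Listₚ.lookup-tabulate fibre (cast length-fibres j))

  fibres-partition : IsPartition H fibres
  fibres-partition (a , x) = cast (sym length-fibres) x , on-own-fibre , only-own-fibre
    where
      on-own-fibre : OnPath H (a , x) (List.lookup fibres (cast (sym length-fibres) x))
      on-own-fibre = subst (OnPath H (a , x)) (sym (Listₚ.lookup-tabulate fibre x))
                       (a , lookup∘tabulate (at x) a)

      only-own-fibre : ∀ j → OnPath H (a , x) (List.lookup fibres j) → j ≡ cast (sym length-fibres) x
      only-own-fibre j on with i , eq ← subst (OnPath H (a , x)) (lookup-fibres j) on =
        trans (sym (Finₚ.cast-involutive _ length-fibres j))
              (cong (cast (sym length-fibres))
                    (cong proj₂ (trans (sym (lookup∘tabulate (at (cast length-fibres j)) i)) eq)))

-- Connectedness is implied by the existence of a diameter, so the hypothesis is unused.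
lemma4 : (n : ℕ) (G : Graph (Fin n)) → Connected G →
    (r : ℕ) → .{{_ : NonZero r}} →
    (D : ℕ) → IsDiam G D → D * n ≤ r →
    ∃[ c ] ∃[ p ] (IsIPc (P r □ G) c × IsIPp (P r □ G) p × c ≤ p × n ≤ c)
lemma4 n G _ (suc r′) D diam Dn≤r =
  n , n , ((fibres , IsPartition⇒IsCover H fibres fibres-partition , length-fibres) , cover-lower-bound)
        , ((fibres , fibres-partition , length-fibres)
          , λ ps part → cover-lower-bound ps (IsPartition⇒IsCover H ps part))
        , ≤-refl , ≤-refl
  where
    open Fibres {r′} G
    cover-lower-bound : ∀ ps → IsCover H ps → n ≤ length ps
    cover-lower-bound ps cover = cover-size⇒≤ (suc r′) n (length ps) D Dn≤r (□-cover-size G diam ps cover)
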